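{- For each positive integer $n$, let $a(n)$ be the number of $4 \times 2n$ matrices with entries in $\{0,1\}$ such that every row contains exactly $n$ ones and every column contains exactly $2$ ones. Then for all positive integers $n$, $$36(2n+3)(2n+1)(n+1)\,a(n) - 2(2n+3)\left(10n^2+30n+23\right)a(n+1) + (n+2)^3\,a(n+2) = 0.$$ -}

module Defs where

open import Data.Nat using (ℕ; zero; suc; _+_; _*_; _≟_)
open import Data.Bool using (Bool; true; false)
open import Data.List using (List; []; _∷_; map; concatMap; filter; length)
open import Data.Vec using (Vec; []; _∷_; foldr; zipWith; replicate)
open import Data.Product using (_×_)
open import Relation.Nullary.Decidable using (_×-dec_)
open import Relation.Binary.PropositionalEquality using (_≡_)
open import Relation.Unary using (Decidable)
open import Relation.Nullary using (Dec)

allBoolVecs : (m : ℕ) → List (Vec Bool m)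
allBoolVecs zero = [] ∷ []
allBoolVecs (suc m) = concatMap (λ v → (false ∷ v) ∷ (true ∷ v) ∷ []) (allBoolVecs m)

allVecsOver : {A : Set} → List A → (k : ℕ) → List (Vec A k)
allVecsOver xs zero = [] ∷ []
allVecsOver xs (suc k) = concatMap (λ v → map (λ x → x ∷ v) xs) (allVecsOver xs k)

Matrix4 : ℕ → Set
Matrix4 m = Vec (Vec Bool m) 4

allMatrices4 : (m : ℕ) → List (Matrix4 m)
allMatrices4 m = allVecsOver (allBoolVecs m) 4

b2n : Bool → ℕ
b2n true = 1
b2n false = 0

rowSum : {m : ℕ} → Vec Bool m → ℕ
rowSum = foldr _ (λ b s → b2n b + s) 0

colSums : {k m : ℕ} → Vec (Vec Bool m) k → Vec ℕ m
colSums {m = m} = foldr _ (λ r acc → zipWith (λ b s → b2n b + s) r acc) (replicate m 0)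

AllEq : {k : ℕ} → ℕ → Vec ℕ k → Set
AllEq c [] = Data.Unit.⊤ where import Data.Unit
AllEq c (x ∷ xs) = (x ≡ c) × AllEq c xs

allEq? : {k : ℕ} (c : ℕ) (v : Vec ℕ k) → Dec (AllEq c v)
allEq? c [] = Relation.Nullary.yes Data.Unit.tt where import Data.Unit
allEq? c (x ∷ xs) = (x ≟ c) ×-dec allEq? c xs

Good : (n : ℕ) → Matrix4 (2 * n) → Set
Good n M = AllEq n (Data.Vec.map rowSum M) × AllEq 2 (colSums M)

good? : (n : ℕ) → Decidable (Good n)
good? n M = allEq? n (Data.Vec.map rowSum M) ×-dec allEq? 2 (colSums M)

a : ℕ → ℕ
a n = length (filter (good? n) (allMatrices4 (2 * n)))

{-# OPTIONS --safe #-}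
-- Write the matrix as rows r₁ r₂ r₃ r₄. Given r₃ and r₄, a column where both vanish forces ones in
-- r₁ and r₂, a column where both are 1 forces zeros, and a column with a single 1 leaves the choice
-- of which of r₁, r₂ carries the other 1; so if r₃ and r₄ (with n ones each) share n − p zeros, they
-- have C(2p, p) completions. There are C(n, p)² such r₃ for each of the C(2n, n) rows r₄, whence
-- a(n) = C(2n, n) b(n) with b(n) = ∑ₖ C(n, k)² C(2k, k). By the Wilf–Zeilberger method b satisfies
-- 9(n+1)² b(n) − (10n² + 30n + 23) b(n+1) + (n+2)² b(n+2) = 0, and together with
-- (n+1) C(2n+2, n+1) = 2(2n+1) C(2n, n) the claimed expression becomes 2(2n+3) C(2n+2, n+1) times
-- the left-hand side of that recurrence.
module Submission where

open import Defs

module Sums where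

  open import Data.Bool using (true; false)
  open import Data.List using (List; []; _∷_; _++_; map; concatMap; filter; length)
  open import Data.Nat using (ℕ; zero; suc; _+_; _*_; _≤_; _<_; _≤′_; ≤′-refl; ≤′-step; _≡ᵇ_; z≤n; s≤s)
  open import Data.Nat.Properties
  open import Algebra.Properties.CommutativeSemigroup +-commutativeSemigroup using (interchange)
  open import Relation.Binary.PropositionalEquality
  open import Relation.Nullary using (does)
  open import Relation.Unary using (Decidable)
  open ≡-Reasoning

  sumOver : {A : Set} → List A → (A → ℕ) → ℕ
  sumOver []       f = 0
  sumOver (x ∷ xs) f = f x + sumOver xs f

  syntax sumOver xs (λ x → e) = ∑[ x ∈ xs ] e

  ∑-cong : {A : Set} (xs : List A) {f g : A → ℕ} → (∀ x → f x ≡ g x) → sumOver xs f ≡ sumOver xs g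
  ∑-cong []       f≗g = refl
  ∑-cong (x ∷ xs) f≗g = cong₂ _+_ (f≗g x) (∑-cong xs f≗g)

  ∑-+ : {A : Set} (xs : List A) (f g : A → ℕ) → ∑[ x ∈ xs ] (f x + g x) ≡ sumOver xs f + sumOver xs g
  ∑-+ []       f g = refl
  ∑-+ (x ∷ xs) f g = trans (cong (f x + g x +_) (∑-+ xs f g)) (interchange (f x) (g x) _ _)

  ∑-*ˡ : {A : Set} (xs : List A) (c : ℕ) (f : A → ℕ) → ∑[ x ∈ xs ] (c * f x) ≡ c * sumOver xs f
  ∑-*ˡ []       c f = sym (*-zeroʳ c)
  ∑-*ˡ (x ∷ xs) c f = trans (cong (c * f x +_) (∑-*ˡ xs c f)) (sym (*-distribˡ-+ c (f x) _))

  ∑∑-*ˡ : {A B : Set} (xs : List A) (ys : List B) (c : ℕ) (f : A → B → ℕ) →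
          ∑[ x ∈ xs ] ∑[ y ∈ ys ] (c * f x y) ≡ c * ∑[ x ∈ xs ] ∑[ y ∈ ys ] f x y
  ∑∑-*ˡ xs ys c f = trans (∑-cong xs (λ x → ∑-*ˡ ys c (f x))) (∑-*ˡ xs c _)

  ∑-++ : {A : Set} (xs ys : List A) (f : A → ℕ) → sumOver (xs ++ ys) f ≡ sumOver xs f + sumOver ys f
  ∑-++ []       ys f = refl
  ∑-++ (x ∷ xs) ys f = trans (cong (f x +_) (∑-++ xs ys f)) (sym (+-assoc (f x) _ _))

  ∑-map : {A B : Set} (g : A → B) (xs : List A) (f : B → ℕ) → sumOver (map g xs) f ≡ ∑[ x ∈ xs ] f (g x)
  ∑-map g []       f = refl
  ∑-map g (x ∷ xs) f = cong (f (g x) +_) (∑-map g xs f)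

  ∑-concatMap : {A B : Set} (g : A → List B) (xs : List A) (f : B → ℕ) →
                sumOver (concatMap g xs) f ≡ ∑[ x ∈ xs ] sumOver (g x) f
  ∑-concatMap g []       f = refl
  ∑-concatMap g (x ∷ xs) f = trans (∑-++ (g x) _ f) (cong (sumOver (g x) f +_) (∑-concatMap g xs f))

  length-filter≡∑ : {A : Set} {P : A → Set} (P? : Decidable P) (xs : List A) →
                  length (filter P? xs) ≡ ∑[ x ∈ xs ] b2n (does (P? x))
  length-filter≡∑ P? []       = refl
  length-filter≡∑ P? (x ∷ xs) with does (P? x)
  ... | true  = cong suc (length-filter≡∑ P? xs)
  ... | false = length-filter≡∑ P? xs

  sumBelow : ℕ → (ℕ → ℕ) → ℕ
  sumBelow zero    f = 0
  sumBelow (suc n) f = f 0 + sumBelow n (λ k → f (suc k))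

  syntax sumBelow n (λ k → e) = ∑[ k < n ] e

  ∑<-cong : ∀ n {f g : ℕ → ℕ} → (∀ k → k < n → f k ≡ g k) → sumBelow n f ≡ sumBelow n g
  ∑<-cong zero    f≗g = refl
  ∑<-cong (suc n) f≗g = cong₂ _+_ (f≗g 0 (s≤s z≤n)) (∑<-cong n (λ k k<n → f≗g (suc k) (s≤s k<n)))

  ∑<-+ : ∀ n (f g : ℕ → ℕ) → ∑[ k < n ] (f k + g k) ≡ sumBelow n f + sumBelow n g
  ∑<-+ zero    f g = refl
  ∑<-+ (suc n) f g = trans (cong (f 0 + g 0 +_) (∑<-+ n _ _)) (interchange (f 0) (g 0) _ _)

  ∑<-zero : ∀ n → ∑[ k < n ] 0 ≡ 0
  ∑<-zero zero    = refl
  ∑<-zero (suc n) = ∑<-zero n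

  ∑<-snoc : ∀ n (f : ℕ → ℕ) → sumBelow (suc n) f ≡ sumBelow n f + f n
  ∑<-snoc zero    f = +-identityʳ (f 0)
  ∑<-snoc (suc n) f = trans (cong (f 0 +_) (∑<-snoc n _)) (sym (+-assoc (f 0) _ _))

  ∑<-extend : ∀ {m n} (f : ℕ → ℕ) → m ≤′ n → (∀ k → m ≤ k → f k ≡ 0) → sumBelow n f ≡ sumBelow m f
  ∑<-extend f ≤′-refl         f≡0 = refl
  ∑<-extend {m} f (≤′-step {n} m≤′n) f≡0 = begin
    sumBelow (suc n) f    ≡⟨ ∑<-snoc n f ⟩
    sumBelow n f + f n    ≡⟨ cong₂ _+_ (∑<-extend f m≤′n f≡0) (f≡0 n (≤′⇒≤ m≤′n)) ⟩
    sumBelow m f + 0      ≡⟨ +-identityʳ _ ⟩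
    sumBelow m f          ∎

  δ : ℕ → ℕ → ℕ
  δ m n = b2n (m ≡ᵇ n)

  δ-refl : ∀ n → δ n n ≡ 1
  δ-refl zero    = refl
  δ-refl (suc n) = δ-refl n

  δ-+-cancelˡ : ∀ c {t n} i → c + t ≡ n → δ (c + i) n ≡ δ i t
  δ-+-cancelˡ zero    i refl = refl
  δ-+-cancelˡ (suc c) i refl = δ-+-cancelˡ c i refl

  ∑<-δ : ∀ n t (f : ℕ → ℕ) → t < n → ∑[ k < n ] (δ k t * f k) ≡ f t
  ∑<-δ (suc n) zero    f _         = trans (cong₂ _+_ (+-identityʳ (f 0)) (∑<-zero n)) (+-identityʳ (f 0))
  ∑<-δ (suc n) (suc t) f (s≤s t<n) = ∑<-δ n t (λ k → f (suc k)) t<n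

module Binomials where

  open import Data.Nat using (ℕ; zero; suc; _+_; _*_; _∸_; _≤_; ≤′-refl; ≤′-step; z≤n; s≤s)
  open import Data.Nat.Combinatorics using (_C_; k>n⇒nCk≡0; nC1≡n; nCk≡nC[n∸k]; nCk+nC[k+1]≡[n+1]C[k+1])
  open import Data.Nat.Properties
  open import Algebra.Properties.CommutativeSemigroup *-commutativeSemigroup
    using () renaming (x∙yz≈y∙xz to x*[y*z]≡y*[x*z])
  open import Data.Nat.Tactic.RingSolver using (solve-∀)
  open import Relation.Binary.PropositionalEquality
  open ≡-Reasoning
  open Sums

  [k+1]*[n+1]C[k+1]≡[n+1]*nCk : ∀ n k → suc k * (suc n C suc k) ≡ suc n * (n C k)
  [k+1]*[n+1]C[k+1]≡[n+1]*nCk n       zero    =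
    trans (*-identityˡ (suc n C 1)) (trans (nC1≡n (suc n)) (sym (*-identityʳ (suc n))))
  [k+1]*[n+1]C[k+1]≡[n+1]*nCk zero    (suc k) =
    trans (cong (suc (suc k) *_) (k>n⇒nCk≡0 (s≤s (s≤s (z≤n {k}))))) (*-zeroʳ (suc (suc k)))
  [k+1]*[n+1]C[k+1]≡[n+1]*nCk (suc n) (suc k) = begin
    suc (suc k) * (suc (suc n) C suc (suc k))
      ≡⟨ cong (suc (suc k) *_) (nCk+nC[k+1]≡[n+1]C[k+1] (suc n) (suc k)) ⟨
    suc (suc k) * (suc n C suc k + suc n C suc (suc k))
      ≡⟨ *-distribˡ-+ (suc (suc k)) (suc n C suc k) (suc n C suc (suc k)) ⟩
    suc n C suc k + suc k * (suc n C suc k) + suc (suc k) * (suc n C suc (suc k))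
      ≡⟨ cong₂ (λ x y → suc n C suc k + x + y)
               ([k+1]*[n+1]C[k+1]≡[n+1]*nCk n k) ([k+1]*[n+1]C[k+1]≡[n+1]*nCk n (suc k)) ⟩
    suc n C suc k + suc n * (n C k) + suc n * (n C suc k)
      ≡⟨ +-assoc (suc n C suc k) _ _ ⟩
    suc n C suc k + (suc n * (n C k) + suc n * (n C suc k))
      ≡⟨ cong (suc n C suc k +_) (sym (*-distribˡ-+ (suc n) (n C k) (n C suc k))) ⟩
    suc n C suc k + suc n * (n C k + n C suc k)
      ≡⟨ cong (λ x → suc n C suc k + suc n * x) (nCk+nC[k+1]≡[n+1]C[k+1] n k) ⟩
    suc (suc n) * (suc n C suc k) ∎

  -- (k + 1) C(n, k + 1) = (n − k) C(n, k), stated without truncated subtraction.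
  [k+1]*nC[k+1]+k*nCk≡n*nCk : ∀ n k → suc k * (n C suc k) + k * (n C k) ≡ n * (n C k)
  [k+1]*nC[k+1]+k*nCk≡n*nCk zero    zero    = refl
  [k+1]*nC[k+1]+k*nCk≡n*nCk zero    (suc k) = cong₂ _+_ (*-zeroʳ (suc (suc k))) (*-zeroʳ (suc k))
  [k+1]*nC[k+1]+k*nCk≡n*nCk (suc n) zero    =
    trans (+-identityʳ (1 * (suc n C 1))) ([k+1]*[n+1]C[k+1]≡[n+1]*nCk n 0)
  [k+1]*nC[k+1]+k*nCk≡n*nCk (suc n) (suc k) = begin
    suc (suc k) * (suc n C suc (suc k)) + suc k * (suc n C suc k)
      ≡⟨ cong₂ _+_ ([k+1]*[n+1]C[k+1]≡[n+1]*nCk n (suc k)) ([k+1]*[n+1]C[k+1]≡[n+1]*nCk n k) ⟩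
    suc n * (n C suc k) + suc n * (n C k)
      ≡⟨ sym (*-distribˡ-+ (suc n) (n C suc k) (n C k)) ⟩
    suc n * (n C suc k + n C k)
      ≡⟨ cong (suc n *_) (trans (+-comm (n C suc k) (n C k)) (nCk+nC[k+1]≡[n+1]C[k+1] n k)) ⟩
    suc n * (suc n C suc k) ∎

  centralBinomial : ℕ → ℕ
  centralBinomial n = (2 * n) C n

  [1+2j]C[1+j]≡[1+2j]Cj : ∀ j → suc (2 * j) C suc j ≡ suc (2 * j) C j
  [1+2j]C[1+j]≡[1+2j]Cj j = sym (trans (nCk≡nC[n∸k] j≤1+2j) (cong (suc (2 * j) C_) 1+2j∸j≡1+j))
    where
    j≤1+2j : j ≤ suc (2 * j)
    j≤1+2j = m≤n⇒m≤1+n (m≤m+n j (j + 0))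
    1+2j∸j≡1+j : suc (2 * j) ∸ j ≡ suc j
    1+2j∸j≡1+j = trans (+-∸-assoc 1 (m≤m+n j (j + 0))) (cong suc (trans (m+n∸m≡n j (j + 0)) (+-identityʳ j)))

  centralBinomial-suc : ∀ j → suc j * centralBinomial (suc j) ≡ 2 * suc (2 * j) * centralBinomial j
  centralBinomial-suc j = *-cancelˡ-≡ _ _ (suc j) (begin
    suc j * (suc j * ((2 * suc j) C suc j))
      ≡⟨ cong (λ m → suc j * (suc j * (m C suc j))) (*-suc 2 j) ⟩
    suc j * (suc j * (suc (suc (2 * j)) C suc j))
      ≡⟨ cong (suc j *_) ([k+1]*[n+1]C[k+1]≡[n+1]*nCk (suc (2 * j)) j) ⟩
    suc j * (suc (suc (2 * j)) * (suc (2 * j) C j))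
      ≡⟨ cong (λ x → suc j * (suc (suc (2 * j)) * x)) ([1+2j]C[1+j]≡[1+2j]Cj j) ⟨
    suc j * (suc (suc (2 * j)) * (suc (2 * j) C suc j))
      ≡⟨ x*[y*z]≡y*[x*z] (suc j) (suc (suc (2 * j))) (suc (2 * j) C suc j) ⟩
    suc (suc (2 * j)) * (suc j * (suc (2 * j) C suc j))
      ≡⟨ cong (suc (suc (2 * j)) *_) ([k+1]*[n+1]C[k+1]≡[n+1]*nCk (2 * j) j) ⟩
    suc (suc (2 * j)) * (suc (2 * j) * centralBinomial j)
      ≡⟨ regroup j (centralBinomial j) ⟩
    suc j * (2 * suc (2 * j) * centralBinomial j) ∎)
    where
    regroup : ∀ j c → suc (suc (2 * j)) * (suc (2 * j) * c) ≡ suc j * (2 * suc (2 * j) * c)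
    regroup = solve-∀

  ∑-Pascal : ∀ o (h : ℕ → ℕ) →
             ∑[ i < suc (suc o) ] ((suc o C i) * h i) ≡ ∑[ i < suc o ] ((o C i) * (h i + h (suc i)))
  ∑-Pascal o h = begin
    1 * h 0 + ∑[ i < suc o ] ((suc o C suc i) * h (suc i))
      ≡⟨ cong (1 * h 0 +_) (∑<-cong (suc o) (λ i _ → pascal i)) ⟩
    1 * h 0 + ∑[ i < suc o ] ((o C i) * h (suc i) + (o C suc i) * h (suc i))
      ≡⟨ cong (1 * h 0 +_) (∑<-+ (suc o) (λ i → (o C i) * h (suc i)) (λ i → (o C suc i) * h (suc i))) ⟩
    1 * h 0 + (∑[ i < suc o ] ((o C i) * h (suc i)) + ∑[ i < suc o ] ((o C suc i) * h (suc i)))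
      ≡⟨ cong (λ x → 1 * h 0 + (∑[ i < suc o ] ((o C i) * h (suc i)) + x)) top-vanishes ⟩
    1 * h 0 + (∑[ i < suc o ] ((o C i) * h (suc i)) + ∑[ i < o ] ((o C suc i) * h (suc i)))
      ≡⟨ x+[y+z]≡[x+z]+y (1 * h 0) _ _ ⟩
    ∑[ i < suc o ] ((o C i) * h i) + ∑[ i < suc o ] ((o C i) * h (suc i))
      ≡⟨ ∑<-+ (suc o) (λ i → (o C i) * h i) (λ i → (o C i) * h (suc i)) ⟨
    ∑[ i < suc o ] ((o C i) * h i + (o C i) * h (suc i))
      ≡⟨ ∑<-cong (suc o) (λ i _ → *-distribˡ-+ (o C i) (h i) (h (suc i))) ⟨
    ∑[ i < suc o ] ((o C i) * (h i + h (suc i))) ∎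
    where
    pascal : ∀ i → (suc o C suc i) * h (suc i) ≡ (o C i) * h (suc i) + (o C suc i) * h (suc i)
    pascal i = trans (cong (_* h (suc i)) (sym (nCk+nC[k+1]≡[n+1]C[k+1] o i)))
                     (*-distribʳ-+ (h (suc i)) (o C i) (o C suc i))
    top-vanishes : ∑[ i < suc o ] ((o C suc i) * h (suc i)) ≡ ∑[ i < o ] ((o C suc i) * h (suc i))
    top-vanishes = ∑<-extend {o} (λ i → (o C suc i) * h (suc i)) (≤′-step ≤′-refl)
                             (λ i o≤i → cong (_* h (suc i)) (k>n⇒nCk≡0 (s≤s o≤i)))
    x+[y+z]≡[x+z]+y : ∀ x y z → x + (y + z) ≡ (x + z) + y
    x+[y+z]≡[x+z]+y = solve-∀

  -- ∑_{i + j = o} C(o, i) ψ(i, j); opaque, so that ψ can be inferred when the lemmas below are applied.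
  opaque

    binomialSum : ℕ → (ℕ → ℕ → ℕ) → ℕ
    binomialSum o ψ = ∑[ i < suc o ] ((o C i) * ψ i (o ∸ i))

    binomialSum-unfold : ∀ o ψ → binomialSum o ψ ≡ ∑[ i < suc o ] ((o C i) * ψ i (o ∸ i))
    binomialSum-unfold o ψ = refl

    binomialSum-zero : ∀ ψ → binomialSum 0 ψ ≡ ψ 0 0
    binomialSum-zero ψ = trans (+-identityʳ (1 * ψ 0 0)) (*-identityˡ (ψ 0 0))

    binomialSum-cong : ∀ o {ψ χ : ℕ → ℕ → ℕ} → (∀ i → i ≤ o → ψ i (o ∸ i) ≡ χ i (o ∸ i)) →
                       binomialSum o ψ ≡ binomialSum o χ
    binomialSum-cong o ψ≗χ = ∑<-cong (suc o) (λ i i<1+o → cong ((o C i) *_) (ψ≗χ i (≤-pred i<1+o)))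

    binomialSum-+ : ∀ o (ψ χ : ℕ → ℕ → ℕ) →
                    binomialSum o (λ i j → ψ i j + χ i j) ≡ binomialSum o ψ + binomialSum o χ
    binomialSum-+ o ψ χ =
      trans (∑<-cong (suc o) (λ i _ → *-distribˡ-+ (o C i) (ψ i (o ∸ i)) (χ i (o ∸ i))))
            (∑<-+ (suc o) (λ i → (o C i) * ψ i (o ∸ i)) (λ i → (o C i) * χ i (o ∸ i)))

    binomialSum-suc : ∀ o (ψ : ℕ → ℕ → ℕ) →
                      binomialSum (suc o) ψ ≡ binomialSum o (λ i j → ψ i (suc j) + ψ (suc i) j)
    binomialSum-suc o ψ = trans (∑-Pascal o (λ i → ψ i (suc o ∸ i)))
      (∑<-cong (suc o) (λ i i<1+o → cong (λ j → (o C i) * (ψ i j + ψ (suc i) (o ∸ i)))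
                                         (+-∸-assoc 1 (≤-pred i<1+o))))

    binomialSum-δ : ∀ {o t} (ψ : ℕ → ℕ → ℕ) → t ≤ o →
                    binomialSum o (λ i j → δ i t * ψ i j) ≡ (o C t) * ψ t (o ∸ t)
    binomialSum-δ {o} {t} ψ t≤o =
      trans (∑<-cong (suc o) (λ i _ → x*[y*z]≡y*[x*z] (o C i) (δ i t) (ψ i (o ∸ i))))
            (∑<-δ (suc o) t (λ i → (o C i) * ψ i (o ∸ i)) (s≤s t≤o))

  binomialSum-offset-suc : ∀ u d (φ : ℕ → ℕ → ℕ) →
    binomialSum d (λ i j → φ (suc (u + i)) (u + j) + φ (u + i) (suc (u + j)))
      ≡ binomialSum (suc d) (λ i j → φ (u + i) (u + j))
  binomialSum-offset-suc u d φ = sym (trans (binomialSum-suc d (λ i j → φ (u + i) (u + j)))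
    (binomialSum-cong d (λ i _ → trans (+-comm (φ (u + i) (u + suc (d ∸ i))) _)
                                       (cong₂ _+_ (cong (λ x → φ x (u + (d ∸ i))) (+-suc u i))
                                                  (cong (φ (u + i)) (+-suc u (d ∸ i)))))))

module Enumeration where

  open import Data.Bool using (Bool; true; false; _∧_)
  open import Data.List using (List; []; _∷_)
  open import Data.Nat using (ℕ; zero; suc; _+_; _*_; _∸_; _≤_; _≡ᵇ_)
  open import Data.Nat.Combinatorics using (_C_)
  open import Data.Nat.Properties
  open import Data.Nat.Tactic.RingSolver using (solve-∀)
  open import Data.Vec using (Vec; []; _∷_)
  open import Relation.Binary.PropositionalEquality
  open import Relation.Nullary using (does)
  open ≡-Reasoning
  open Sums
  open Binomials

  ∑-allBoolVecs-suc : ∀ m (f : Vec Bool (suc m) → ℕ) →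
    sumOver (allBoolVecs (suc m)) f ≡ ∑[ r ∈ allBoolVecs m ] (f (false ∷ r) + f (true ∷ r))
  ∑-allBoolVecs-suc m f =
    trans (∑-concatMap _ (allBoolVecs m) f)
          (∑-cong (allBoolVecs m) (λ r → cong (f (false ∷ r) +_) (+-identityʳ (f (true ∷ r)))))

  zeroCount : ∀ {m} → Vec Bool m → ℕ
  zeroCount []          = 0
  zeroCount (false ∷ r) = suc (zeroCount r)
  zeroCount (true  ∷ r) = zeroCount r

  ∑-rowSum-zeroCount : ∀ m (φ : ℕ → ℕ → ℕ) →
    ∑[ r ∈ allBoolVecs m ] φ (rowSum r) (zeroCount r) ≡ binomialSum m φ
  ∑-rowSum-zeroCount zero    φ = trans (+-identityʳ (φ 0 0)) (sym (binomialSum-zero φ))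
  ∑-rowSum-zeroCount (suc m) φ = begin
    ∑[ r ∈ allBoolVecs (suc m) ] φ (rowSum r) (zeroCount r)
      ≡⟨ ∑-allBoolVecs-suc m _ ⟩
    ∑[ r ∈ allBoolVecs m ] (φ (rowSum r) (suc (zeroCount r)) + φ (suc (rowSum r)) (zeroCount r))
      ≡⟨ ∑-rowSum-zeroCount m (λ i j → φ i (suc j) + φ (suc i) j) ⟩
    binomialSum m (λ i j → φ i (suc j) + φ (suc i) j)
      ≡⟨ binomialSum-suc m φ ⟨
    binomialSum (suc m) φ ∎

  bothZero : ∀ {m} → Vec Bool m → Vec Bool m → ℕ
  bothZero []          []          = 0
  bothZero (false ∷ r) (false ∷ s) = suc (bothZero r s)
  bothZero (false ∷ r) (true  ∷ s) = bothZero r s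
  bothZero (true  ∷ r) (_     ∷ s) = bothZero r s

  exactlyOne : ∀ {m} → Vec Bool m → Vec Bool m → ℕ
  exactlyOne []          []          = 0
  exactlyOne (false ∷ r) (false ∷ s) = exactlyOne r s
  exactlyOne (false ∷ r) (true  ∷ s) = suc (exactlyOne r s)
  exactlyOne (true  ∷ r) (false ∷ s) = suc (exactlyOne r s)
  exactlyOne (true  ∷ r) (true  ∷ s) = exactlyOne r s

  -- Of the ones of r, p face a zero of s; of the zeros of r, q face a one of s.
  ∑-pairStatistics : ∀ {m} (r : Vec Bool m) (g : ℕ → ℕ → ℕ → ℕ) →
    ∑[ s ∈ allBoolVecs m ] g (rowSum s) (bothZero s r) (exactlyOne s r)
      ≡ binomialSum (rowSum r) (λ p p′ → binomialSum (zeroCount r) (λ q q′ → g (p′ + q) q′ (p + q)))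
  ∑-pairStatistics [] g =
    trans (+-identityʳ (g 0 0 0)) (sym (trans (binomialSum-zero _) (binomialSum-zero _)))
  ∑-pairStatistics {suc m} (true ∷ r) g = begin
    ∑[ s ∈ allBoolVecs (suc m) ] g (rowSum s) (bothZero s (true ∷ r)) (exactlyOne s (true ∷ r))
      ≡⟨ ∑-allBoolVecs-suc m _ ⟩
    ∑[ s ∈ allBoolVecs m ] (g (rowSum s) (bothZero s r) (suc (exactlyOne s r))
                            + g (suc (rowSum s)) (bothZero s r) (exactlyOne s r))
      ≡⟨ ∑-pairStatistics r (λ s u d → g s u (suc d) + g (suc s) u d) ⟩
    binomialSum o (λ p p′ → binomialSum z (λ q q′ → g (p′ + q) q′ (suc (p + q))
                                                   + g (suc (p′ + q)) q′ (p + q)))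
      ≡⟨ binomialSum-cong o (λ p _ → binomialSum-+ z (λ q q′ → g (o ∸ p + q) q′ (suc (p + q)))
                                                      (λ q q′ → g (suc (o ∸ p + q)) q′ (p + q))) ⟩
    binomialSum o (λ p p′ → binomialSum z (λ q q′ → g (p′ + q) q′ (suc p + q))
                           + binomialSum z (λ q q′ → g (suc p′ + q) q′ (p + q)))
      ≡⟨ binomialSum-cong o (λ p _ → +-comm (binomialSum z (λ q q′ → g (o ∸ p + q) q′ (suc p + q))) _) ⟩
    binomialSum o (λ p p′ → binomialSum z (λ q q′ → g (suc p′ + q) q′ (p + q))
                           + binomialSum z (λ q q′ → g (p′ + q) q′ (suc p + q)))
      ≡⟨ binomialSum-suc o (λ p p′ → binomialSum z (λ q q′ → g (p′ + q) q′ (p + q))) ⟨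
    binomialSum (suc o) (λ p p′ → binomialSum z (λ q q′ → g (p′ + q) q′ (p + q))) ∎
    where
    o = rowSum r
    z = zeroCount r
  ∑-pairStatistics {suc m} (false ∷ r) g = begin
    ∑[ s ∈ allBoolVecs (suc m) ] g (rowSum s) (bothZero s (false ∷ r)) (exactlyOne s (false ∷ r))
      ≡⟨ ∑-allBoolVecs-suc m _ ⟩
    ∑[ s ∈ allBoolVecs m ] (g (rowSum s) (suc (bothZero s r)) (exactlyOne s r)
                            + g (suc (rowSum s)) (bothZero s r) (suc (exactlyOne s r)))
      ≡⟨ ∑-pairStatistics r (λ s u d → g s (suc u) d + g (suc s) u (suc d)) ⟩
    binomialSum o (λ p p′ → binomialSum z (λ q q′ → g (p′ + q) (suc q′) (p + q)
                                                   + g (suc (p′ + q)) q′ (suc (p + q))))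
      ≡⟨ binomialSum-cong o (λ p _ → binomialSum-cong z (λ q _ → cong (g (o ∸ p + q) (suc (z ∸ q)) (p + q) +_)
                                                                    (shift (o ∸ p) p q))) ⟩
    binomialSum o (λ p p′ → binomialSum z (λ q q′ → g (p′ + q) (suc q′) (p + q)
                                                   + g (p′ + suc q) q′ (p + suc q)))
      ≡⟨ binomialSum-cong o (λ p _ → binomialSum-suc z (λ q q′ → g (o ∸ p + q) q′ (p + q))) ⟨
    binomialSum o (λ p p′ → binomialSum (suc z) (λ q q′ → g (p′ + q) q′ (p + q))) ∎
    where
    o = rowSum r
    z = zeroCount r
    shift : ∀ p′ p q → g (suc (p′ + q)) (z ∸ q) (suc (p + q)) ≡ g (p′ + suc q) (z ∸ q) (p + suc q)
    shift p′ p q = sym (cong₂ (λ x y → g x (z ∸ q) y) (+-suc p′ q) (+-suc p q))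

  columnsTwo : ∀ {m} → Vec Bool m → Vec Bool m → Vec Bool m → Vec Bool m → ℕ
  columnsTwo r₁ r₂ r₃ r₄ = b2n (does (allEq? 2 (colSums (r₁ ∷ r₂ ∷ r₃ ∷ r₄ ∷ []))))

  b2n-∧ : ∀ x y → b2n (x ∧ y) ≡ b2n x * b2n y
  b2n-∧ false y = refl
  b2n-∧ true  y = sym (+-identityʳ (b2n y))

  columnTwo : Bool → Bool → Bool → Bool → ℕ
  columnTwo b₁ b₂ b₃ b₄ = δ (b2n b₁ + (b2n b₂ + (b2n b₃ + (b2n b₄ + 0)))) 2

  columnsTwo-∷ : ∀ {m} b₁ b₂ b₃ b₄ (r₁ r₂ r₃ r₄ : Vec Bool m) →
    columnsTwo (b₁ ∷ r₁) (b₂ ∷ r₂) (b₃ ∷ r₃) (b₄ ∷ r₄) ≡ columnTwo b₁ b₂ b₃ b₄ * columnsTwo r₁ r₂ r₃ r₄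
  columnsTwo-∷ b₁ b₂ b₃ b₄ r₁ r₂ r₃ r₄ =
    b2n-∧ (b2n b₁ + (b2n b₂ + (b2n b₃ + (b2n b₄ + 0))) ≡ᵇ 2)
          (does (allEq? 2 (colSums (r₁ ∷ r₂ ∷ r₃ ∷ r₄ ∷ []))))

  columnStep : Bool → Bool → (ℕ → ℕ → ℕ) → ℕ → ℕ → ℕ
  columnStep b₃ b₄ φ x y =
      (columnTwo false false b₃ b₄ * φ x y       + columnTwo true false b₃ b₄ * φ (suc x) y)
    + (columnTwo false true  b₃ b₄ * φ x (suc y) + columnTwo true true  b₃ b₄ * φ (suc x) (suc y))

  ∑-completions-∷ : ∀ {m} b₃ b₄ (r₃ r₄ : Vec Bool m) (φ : ℕ → ℕ → ℕ) →
    ∑[ r₂ ∈ allBoolVecs (suc m) ] ∑[ r₁ ∈ allBoolVecs (suc m) ]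
        (columnsTwo r₁ r₂ (b₃ ∷ r₃) (b₄ ∷ r₄) * φ (rowSum r₁) (rowSum r₂))
      ≡ ∑[ r₂ ∈ allBoolVecs m ] ∑[ r₁ ∈ allBoolVecs m ]
        (columnsTwo r₁ r₂ r₃ r₄ * columnStep b₃ b₄ φ (rowSum r₁) (rowSum r₂))
  ∑-completions-∷ {m} b₃ b₄ r₃ r₄ φ = begin
    ∑[ r₂ ∈ V (suc m) ] ∑[ r₁ ∈ V (suc m) ] X r₁ r₂
      ≡⟨ ∑-allBoolVecs-suc m _ ⟩
    ∑[ r₂ ∈ V m ] (∑[ r₁ ∈ V (suc m) ] X r₁ (false ∷ r₂) + ∑[ r₁ ∈ V (suc m) ] X r₁ (true ∷ r₂))
      ≡⟨ ∑-cong (V m) (λ r₂ → cong₂ _+_ (∑-allBoolVecs-suc m _) (∑-allBoolVecs-suc m _)) ⟩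
    ∑[ r₂ ∈ V m ] (∑[ r₁ ∈ V m ] (X (false ∷ r₁) (false ∷ r₂) + X (true ∷ r₁) (false ∷ r₂))
                 + ∑[ r₁ ∈ V m ] (X (false ∷ r₁) (true ∷ r₂) + X (true ∷ r₁) (true ∷ r₂)))
      ≡⟨ ∑-cong (V m) (λ r₂ → ∑-+ (V m) _ _) ⟨
    ∑[ r₂ ∈ V m ] ∑[ r₁ ∈ V m ] ((X (false ∷ r₁) (false ∷ r₂) + X (true ∷ r₁) (false ∷ r₂))
                                + (X (false ∷ r₁) (true ∷ r₂) + X (true ∷ r₁) (true ∷ r₂)))
      ≡⟨ ∑-cong (V m) (λ r₂ → ∑-cong (V m) (λ r₁ → factor r₁ r₂)) ⟩
    ∑[ r₂ ∈ V m ] ∑[ r₁ ∈ V m ] (columnsTwo r₁ r₂ r₃ r₄ * columnStep b₃ b₄ φ (rowSum r₁) (rowSum r₂)) ∎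
    where
    V = allBoolVecs
    X : Vec Bool (suc m) → Vec Bool (suc m) → ℕ
    X r₁ r₂ = columnsTwo r₁ r₂ (b₃ ∷ r₃) (b₄ ∷ r₄) * φ (rowSum r₁) (rowSum r₂)
    distribute : ∀ k w₀₀ w₁₀ w₀₁ w₁₁ f₀₀ f₁₀ f₀₁ f₁₁ →
      (w₀₀ * k * f₀₀ + w₁₀ * k * f₁₀) + (w₀₁ * k * f₀₁ + w₁₁ * k * f₁₁)
        ≡ k * ((w₀₀ * f₀₀ + w₁₀ * f₁₀) + (w₀₁ * f₀₁ + w₁₁ * f₁₁))
    distribute = solve-∀
    factor : ∀ r₁ r₂ → (X (false ∷ r₁) (false ∷ r₂) + X (true ∷ r₁) (false ∷ r₂))
                       + (X (false ∷ r₁) (true ∷ r₂) + X (true ∷ r₁) (true ∷ r₂))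
                     ≡ columnsTwo r₁ r₂ r₃ r₄ * columnStep b₃ b₄ φ (rowSum r₁) (rowSum r₂)
    factor r₁ r₂ =
      trans (cong₂ _+_ (cong₂ _+_ (split false false) (split true false))
                       (cong₂ _+_ (split false true) (split true true)))
            (distribute (columnsTwo r₁ r₂ r₃ r₄) (w false false) (w true false) (w false true) (w true true)
                        (φ x y) (φ (suc x) y) (φ x (suc y)) (φ (suc x) (suc y)))
      where
      x = rowSum r₁
      y = rowSum r₂
      w : Bool → Bool → ℕ
      w b₁ b₂ = columnTwo b₁ b₂ b₃ b₄
      split : ∀ b₁ b₂ → X (b₁ ∷ r₁) (b₂ ∷ r₂) ≡ w b₁ b₂ * columnsTwo r₁ r₂ r₃ r₄ * φ (b2n b₁ + x) (b2n b₂ + y)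
      split b₁ b₂ = cong (_* φ (b2n b₁ + x) (b2n b₂ + y)) (columnsTwo-∷ b₁ b₂ b₃ b₄ r₁ r₂ r₃ r₄)

  columnStep-true-true : ∀ φ x y → columnStep true true φ x y ≡ φ x y
  columnStep-true-true φ x y = trans (+-identityʳ _) (trans (+-identityʳ _) (+-identityʳ (φ x y)))

  columnStep-false-false : ∀ φ x y → columnStep false false φ x y ≡ φ (suc x) (suc y)
  columnStep-false-false φ x y = +-identityʳ (φ (suc x) (suc y))

  columnStep-true-false : ∀ φ x y → columnStep true false φ x y ≡ φ (suc x) y + φ x (suc y)
  columnStep-true-false φ x y =
    cong₂ _+_ (+-identityʳ (φ (suc x) y)) (trans (+-identityʳ _) (+-identityʳ (φ x (suc y))))

  columnStep-false-true : ∀ φ x y → columnStep false true φ x y ≡ φ (suc x) y + φ x (suc y)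
  columnStep-false-true φ x y =
    cong₂ _+_ (+-identityʳ (φ (suc x) y)) (trans (+-identityʳ _) (+-identityʳ (φ x (suc y))))

  ∑-completions : ∀ {m} (r₃ r₄ : Vec Bool m) (φ : ℕ → ℕ → ℕ) →
    ∑[ r₂ ∈ allBoolVecs m ] ∑[ r₁ ∈ allBoolVecs m ] (columnsTwo r₁ r₂ r₃ r₄ * φ (rowSum r₁) (rowSum r₂))
      ≡ binomialSum (exactlyOne r₃ r₄) (λ i j → φ (bothZero r₃ r₄ + i) (bothZero r₃ r₄ + j))
  ∑-completions [] [] φ =
    trans (+-identityʳ _) (trans (+-identityʳ _) (trans (*-identityˡ (φ 0 0)) (sym (binomialSum-zero _))))
  ∑-completions (true ∷ r₃) (true ∷ r₄) φ =
    trans (∑-completions-∷ true true r₃ r₄ φ) (trans (∑-completions r₃ r₄ (columnStep true true φ))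
      (binomialSum-cong (exactlyOne r₃ r₄) (λ _ _ → columnStep-true-true φ _ _)))
  ∑-completions (false ∷ r₃) (false ∷ r₄) φ =
    trans (∑-completions-∷ false false r₃ r₄ φ) (trans (∑-completions r₃ r₄ (columnStep false false φ))
      (binomialSum-cong (exactlyOne r₃ r₄) (λ _ _ → columnStep-false-false φ _ _)))
  ∑-completions (true ∷ r₃) (false ∷ r₄) φ =
    trans (∑-completions-∷ true false r₃ r₄ φ) (trans (∑-completions r₃ r₄ (columnStep true false φ))
      (trans (binomialSum-cong (exactlyOne r₃ r₄) (λ _ _ → columnStep-true-false φ _ _))
             (binomialSum-offset-suc (bothZero r₃ r₄) (exactlyOne r₃ r₄) φ)))
  ∑-completions (false ∷ r₃) (true ∷ r₄) φ =
    trans (∑-completions-∷ false true r₃ r₄ φ) (trans (∑-completions r₃ r₄ (columnStep false true φ))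
      (trans (binomialSum-cong (exactlyOne r₃ r₄) (λ _ _ → columnStep-false-true φ _ _))
             (binomialSum-offset-suc (bothZero r₃ r₄) (exactlyOne r₃ r₄) φ)))

  ∑-allVecsOver-suc : ∀ {A : Set} (xs : List A) k (f : Vec A (suc k) → ℕ) →
    sumOver (allVecsOver xs (suc k)) f ≡ ∑[ v ∈ allVecsOver xs k ] ∑[ x ∈ xs ] f (x ∷ v)
  ∑-allVecsOver-suc xs k f =
    trans (∑-concatMap _ (allVecsOver xs k) f) (∑-cong (allVecsOver xs k) (λ v → ∑-map (_∷ v) xs f))

  ∑-allMatrices4 : ∀ m (f : Matrix4 m → ℕ) →
    sumOver (allMatrices4 m) f
      ≡ ∑[ r₄ ∈ allBoolVecs m ] ∑[ r₃ ∈ allBoolVecs m ] ∑[ r₂ ∈ allBoolVecs m ] ∑[ r₁ ∈ allBoolVecs m ]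
          f (r₁ ∷ r₂ ∷ r₃ ∷ r₄ ∷ [])
  ∑-allMatrices4 m f =
    trans (∑-allVecsOver-suc V 3 f)
    (trans (∑-allVecsOver-suc V 2 (λ v → ∑[ r₁ ∈ V ] f (r₁ ∷ v)))
    (trans (∑-allVecsOver-suc V 1 (λ v → ∑[ r₂ ∈ V ] ∑[ r₁ ∈ V ] f (r₁ ∷ r₂ ∷ v)))
    (trans (∑-allVecsOver-suc V 0 (λ v → ∑[ r₃ ∈ V ] ∑[ r₂ ∈ V ] ∑[ r₁ ∈ V ] f (r₁ ∷ r₂ ∷ r₃ ∷ v)))
           (+-identityʳ _))))
    where
    V = allBoolVecs m

  good-indicator : ∀ n (r₁ r₂ r₃ r₄ : Vec Bool (2 * n)) →
    b2n (does (good? n (r₁ ∷ r₂ ∷ r₃ ∷ r₄ ∷ [])))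
      ≡ δ (rowSum r₄) n * (δ (rowSum r₃) n * (columnsTwo r₁ r₂ r₃ r₄ * (δ (rowSum r₁) n * δ (rowSum r₂) n)))
  good-indicator n r₁ r₂ r₃ r₄ = begin
    b2n ((e₁ ∧ (e₂ ∧ (e₃ ∧ (e₄ ∧ true)))) ∧ cols)
      ≡⟨ b2n-∧ (e₁ ∧ (e₂ ∧ (e₃ ∧ (e₄ ∧ true)))) cols ⟩
    b2n (e₁ ∧ (e₂ ∧ (e₃ ∧ (e₄ ∧ true)))) * b2n cols
      ≡⟨ cong (_* b2n cols) (trans (b2n-∧ e₁ _) (cong (b2n e₁ *_) (trans (b2n-∧ e₂ _)
           (cong (b2n e₂ *_) (trans (b2n-∧ e₃ _) (cong (b2n e₃ *_) (b2n-∧ e₄ true))))))) ⟩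
    b2n e₁ * (b2n e₂ * (b2n e₃ * (b2n e₄ * 1))) * b2n cols
      ≡⟨ rearrange (b2n e₁) (b2n e₂) (b2n e₃) (b2n e₄) (b2n cols) ⟩
    b2n e₄ * (b2n e₃ * (b2n cols * (b2n e₁ * b2n e₂))) ∎
    where
    e₁ = rowSum r₁ ≡ᵇ n
    e₂ = rowSum r₂ ≡ᵇ n
    e₃ = rowSum r₃ ≡ᵇ n
    e₄ = rowSum r₄ ≡ᵇ n
    cols = does (allEq? 2 (colSums (r₁ ∷ r₂ ∷ r₃ ∷ r₄ ∷ [])))
    rearrange : ∀ x₁ x₂ x₃ x₄ c → x₁ * (x₂ * (x₃ * (x₄ * 1))) * c ≡ x₄ * (x₃ * (c * (x₁ * x₂)))
    rearrange = solve-∀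

  a≡∑-rows : ∀ n → let V = allBoolVecs (2 * n) in
    a n ≡ ∑[ r₄ ∈ V ] (δ (rowSum r₄) n * ∑[ r₃ ∈ V ] (δ (rowSum r₃) n *
            ∑[ r₂ ∈ V ] ∑[ r₁ ∈ V ] (columnsTwo r₁ r₂ r₃ r₄ * (δ (rowSum r₁) n * δ (rowSum r₂) n))))
  a≡∑-rows n = begin
    a n
      ≡⟨ length-filter≡∑ (good? n) (allMatrices4 (2 * n)) ⟩
    ∑[ M ∈ allMatrices4 (2 * n) ] b2n (does (good? n M))
      ≡⟨ ∑-allMatrices4 (2 * n) _ ⟩
    ∑[ r₄ ∈ V ] ∑[ r₃ ∈ V ] ∑[ r₂ ∈ V ] ∑[ r₁ ∈ V ] b2n (does (good? n (r₁ ∷ r₂ ∷ r₃ ∷ r₄ ∷ [])))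
      ≡⟨ ∑-cong V (λ r₄ → ∑-cong V (λ r₃ → ∑-cong V (λ r₂ → ∑-cong V (λ r₁ →
           good-indicator n r₁ r₂ r₃ r₄)))) ⟩
    ∑[ r₄ ∈ V ] ∑[ r₃ ∈ V ] ∑[ r₂ ∈ V ] ∑[ r₁ ∈ V ] (δ₄ r₄ * (δ₃ r₃ * X r₁ r₂ r₃ r₄))
      ≡⟨ ∑-cong V (λ r₄ → pull r₄) ⟩
    ∑[ r₄ ∈ V ] (δ₄ r₄ * ∑[ r₃ ∈ V ] (δ₃ r₃ * ∑[ r₂ ∈ V ] ∑[ r₁ ∈ V ] X r₁ r₂ r₃ r₄)) ∎
    where
    V = allBoolVecs (2 * n)
    δ₄ δ₃ : Vec Bool (2 * n) → ℕ
    δ₄ r₄ = δ (rowSum r₄) n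
    δ₃ r₃ = δ (rowSum r₃) n
    X : (r₁ r₂ r₃ r₄ : Vec Bool (2 * n)) → ℕ
    X r₁ r₂ r₃ r₄ = columnsTwo r₁ r₂ r₃ r₄ * (δ (rowSum r₁) n * δ (rowSum r₂) n)
    pull : ∀ r₄ → ∑[ r₃ ∈ V ] ∑[ r₂ ∈ V ] ∑[ r₁ ∈ V ] (δ₄ r₄ * (δ₃ r₃ * X r₁ r₂ r₃ r₄))
                ≡ δ₄ r₄ * ∑[ r₃ ∈ V ] (δ₃ r₃ * ∑[ r₂ ∈ V ] ∑[ r₁ ∈ V ] X r₁ r₂ r₃ r₄)
    pull r₄ = trans (∑-cong V (λ r₃ → ∑∑-*ˡ V V (δ₄ r₄) (λ r₂ r₁ → δ₃ r₃ * X r₁ r₂ r₃ r₄)))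
                    (trans (∑-*ˡ V (δ₄ r₄) _)
                           (cong (δ₄ r₄ *_) (∑-cong V (λ r₃ → ∑∑-*ˡ V V (δ₃ r₃) (λ r₂ r₁ → X r₁ r₂ r₃ r₄)))))

  b : ℕ → ℕ
  b n = binomialSum n (λ k _ → (n C k) * centralBinomial k)

  -- The number of pairs of rows with n ones each that complete two rows having u columns 00
  -- and d columns 01 or 10 to a matrix with column sums 2.
  completionCount : ℕ → ℕ → ℕ → ℕ
  completionCount n u d = binomialSum d (λ i j → δ (u + i) n * δ (u + j) n)

  completionCount-diagonal : ∀ {n p} → p ≤ n → completionCount n (n ∸ p) (p + p) ≡ centralBinomial p
  completionCount-diagonal {n} {p} p≤n = begin
    binomialSum (p + p) (λ i j → δ (n ∸ p + i) n * δ (n ∸ p + j) n)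
      ≡⟨ binomialSum-cong (p + p) (λ i _ → cong (_* δ (n ∸ p + (p + p ∸ i)) n)
                                                (δ-+-cancelˡ (n ∸ p) i n∸p+p≡n)) ⟩
    binomialSum (p + p) (λ i j → δ i p * δ (n ∸ p + j) n)
      ≡⟨ binomialSum-δ (λ _ j → δ (n ∸ p + j) n) (m≤m+n p p) ⟩
    ((p + p) C p) * δ (n ∸ p + (p + p ∸ p)) n
      ≡⟨ cong (λ j → ((p + p) C p) * δ (n ∸ p + j) n) (m+n∸n≡m p p) ⟩
    ((p + p) C p) * δ (n ∸ p + p) n
      ≡⟨ cong (λ m → ((p + p) C p) * δ m n) n∸p+p≡n ⟩
    ((p + p) C p) * δ n n
      ≡⟨ cong₂ (λ m x → (m C p) * x) (cong (p +_) (sym (+-identityʳ p))) (δ-refl n) ⟩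
    centralBinomial p * 1
      ≡⟨ *-identityʳ _ ⟩
    centralBinomial p ∎
    where
    n∸p+p≡n : n ∸ p + p ≡ n
    n∸p+p≡n = m∸n+n≡m p≤n

  pairCount : ℕ → ℕ → ℕ → ℕ
  pairCount n o z =
    binomialSum o (λ p p′ → binomialSum z (λ q q′ → δ (p′ + q) n * completionCount n q′ (p + q)))

  pairCount-diagonal : ∀ n → pairCount n n n ≡ b n
  pairCount-diagonal n = binomialSum-cong n (λ p p≤n → begin
    binomialSum n (λ q q′ → δ (n ∸ p + q) n * completionCount n q′ (p + q))
      ≡⟨ binomialSum-cong n (λ q _ → cong (_* completionCount n (n ∸ q) (p + q))
                                          (δ-+-cancelˡ (n ∸ p) q (m∸n+n≡m p≤n))) ⟩
    binomialSum n (λ q q′ → δ q p * completionCount n q′ (p + q))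
      ≡⟨ binomialSum-δ (λ q q′ → completionCount n q′ (p + q)) p≤n ⟩
    (n C p) * completionCount n (n ∸ p) (p + p)
      ≡⟨ cong ((n C p) *_) (completionCount-diagonal p≤n) ⟩
    (n C p) * centralBinomial p ∎)

  a≡centralBinomial*b : ∀ n → a n ≡ centralBinomial n * b n
  a≡centralBinomial*b n = begin
    a n
      ≡⟨ a≡∑-rows n ⟩
    ∑[ r₄ ∈ V ] (δ (rowSum r₄) n * ∑[ r₃ ∈ V ] (δ (rowSum r₃) n *
      ∑[ r₂ ∈ V ] ∑[ r₁ ∈ V ] (columnsTwo r₁ r₂ r₃ r₄ * (δ (rowSum r₁) n * δ (rowSum r₂) n))))
      ≡⟨ ∑-cong V (λ r₄ → cong (δ (rowSum r₄) n *_) (∑-cong V (λ r₃ → cong (δ (rowSum r₃) n *_)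
           (∑-completions r₃ r₄ (λ x y → δ x n * δ y n))))) ⟩
    ∑[ r₄ ∈ V ] (δ (rowSum r₄) n *
      ∑[ r₃ ∈ V ] (δ (rowSum r₃) n * completionCount n (bothZero r₃ r₄) (exactlyOne r₃ r₄)))
      ≡⟨ ∑-cong V (λ r₄ → cong (δ (rowSum r₄) n *_)
           (∑-pairStatistics r₄ (λ s u d → δ s n * completionCount n u d))) ⟩
    ∑[ r₄ ∈ V ] (δ (rowSum r₄) n * pairCount n (rowSum r₄) (zeroCount r₄))
      ≡⟨ ∑-rowSum-zeroCount (2 * n) (λ o z → δ o n * pairCount n o z) ⟩
    binomialSum (2 * n) (λ o z → δ o n * pairCount n o z)
      ≡⟨ binomialSum-δ (pairCount n) (m≤m+n n (n + 0)) ⟩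
    centralBinomial n * pairCount n n (2 * n ∸ n)
      ≡⟨ cong (λ z → centralBinomial n * pairCount n n z) (trans (m+n∸m≡n n (n + 0)) (+-identityʳ n)) ⟩
    centralBinomial n * pairCount n n n
      ≡⟨ cong (centralBinomial n *_) (pairCount-diagonal n) ⟩
    centralBinomial n * b n ∎
    where
    V = allBoolVecs (2 * n)


module Recurrence where

  open import Data.Integer using (ℤ; +_; _+_; _-_; _*_; -_; 0ℤ)
  open import Data.Integer.Properties using (pos-+; pos-*; +-identityʳ)
  open import Data.Integer.Tactic.RingSolver using (solve-∀)
  open import Data.Nat as ℕ using (ℕ; zero; suc; ≤′-refl; ≤′-step)
  open import Data.Nat.Properties using (n<1+n)
  open import Data.Nat.Combinatorics using (_C_; k>n⇒nCk≡0; nCk+nC[k+1]≡[n+1]C[k+1])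
  open import Relation.Binary.PropositionalEquality
  open ≡-Reasoning
  open Sums using (sumBelow; ∑<-snoc; ∑<-extend)
  open Binomials
    using ( binomialSum-unfold; [k+1]*[n+1]C[k+1]≡[n+1]*nCk; [k+1]*nC[k+1]+k*nCk≡n*nCk
          ; centralBinomial; centralBinomial-suc)
  open Enumeration using (b)

  lincomb-vanishes : ∀ (α β γ : ℤ) {x x′ y y′ z z′ : ℤ} → x ≡ x′ → y ≡ y′ → z ≡ z′ →
                     α * (x - x′) + β * (y - y′) + γ * (z - z′) ≡ 0ℤ
  lincomb-vanishes α β γ {x} {_} {y} {_} {z} refl refl refl = vanish α β γ x y z
    where
    vanish : ∀ α β γ x y z → α * (x - x) + β * (y - y) + γ * (z - z) ≡ 0ℤ
    vanish = solve-∀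

  recurrence : ℤ → ℤ → ℤ → ℤ → ℤ
  recurrence N x₀ x₁ x₂ =
    + 9 * ((N + + 1) * (N + + 1)) * x₀ - (+ 10 * N * N + + 30 * N + + 23) * x₁ + (N + + 2) * (N + + 2) * x₂

  recurrence-cong : ∀ N {x₀ x₁ x₂ y₀ y₁ y₂} → x₀ ≡ y₀ → x₁ ≡ y₁ → x₂ ≡ y₂ →
                    recurrence N x₀ x₁ x₂ ≡ recurrence N y₀ y₁ y₂
  recurrence-cong N refl refl refl = refl

  recurrence-+ : ∀ N x₀ x₁ x₂ y₀ y₁ y₂ →
    recurrence N (x₀ + y₀) (x₁ + y₁) (x₂ + y₂) ≡ recurrence N x₀ x₁ x₂ + recurrence N y₀ y₁ y₂
  recurrence-+ = linear
    where
    linear : ∀ N x₀ x₁ x₂ y₀ y₁ y₂ →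
      + 9 * ((N + + 1) * (N + + 1)) * (x₀ + y₀) - (+ 10 * N * N + + 30 * N + + 23) * (x₁ + y₁)
        + (N + + 2) * (N + + 2) * (x₂ + y₂)
      ≡ (+ 9 * ((N + + 1) * (N + + 1)) * x₀ - (+ 10 * N * N + + 30 * N + + 23) * x₁
           + (N + + 2) * (N + + 2) * x₂)
        + (+ 9 * ((N + + 1) * (N + + 1)) * y₀ - (+ 10 * N * N + + 30 * N + + 23) * y₁
           + (N + + 2) * (N + + 2) * y₂)
    linear = solve-∀

  F : ℕ → ℕ → ℕ
  F n k = (n C k) ℕ.* ((n C k) ℕ.* centralBinomial k)

  certificate : ℤ → ℤ → ℤ → ℤ → ℤ
  certificate N J X D = - (+ 2 * (+ 1 + + 2 * J) * (+ 4 * N + + 5 - + 3 * J)) * (X * X) * D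

  -- The Wilf–Zeilberger certificate of F, as found by Zeilberger's algorithm.
  G : ℕ → ℕ → ℤ
  G n zero    = 0ℤ
  G n (suc j) = certificate (+ n) (+ j) (+ (suc n C j)) (+ centralBinomial j)

  -- Used with X₀ = C(n, j+1), X₁ = C(n+1, j+1), Y = C(n+1, j), D₀ = C(2j, j), D₁ = C(2j+2, j+1).
  wz-identity : ∀ (N J X₀ X₁ Y D₀ D₁ : ℤ) →
    (+ 1 + N) * X₀ + (+ 1 + J) * X₁ ≡ (+ 1 + N) * X₁ →
    (+ 1 + J) * X₁ + J * Y ≡ (+ 1 + N) * Y →
    (+ 1 + J) * D₁ ≡ + 2 * (+ 1 + + 2 * J) * D₀ →
    recurrence N (X₀ * (X₀ * D₁)) (X₁ * (X₁ * D₁)) ((Y + X₁) * ((Y + X₁) * D₁))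
      ≡ certificate N (+ 1 + J) X₁ D₁ - certificate N J Y D₀
  wz-identity N J X₀ X₁ Y D₀ D₁ rel₁ rel₂ rel₃ = begin
    recurrence N (X₀ * (X₀ * D₁)) (X₁ * (X₁ * D₁)) ((Y + X₁) * ((Y + X₁) * D₁))
      ≡⟨ expand N J X₀ X₁ Y D₀ D₁ ⟩
    ΔG + (α * ((+ 1 + N) * X₀ + (+ 1 + J) * X₁ - (+ 1 + N) * X₁)
          + β * ((+ 1 + J) * X₁ + J * Y - (+ 1 + N) * Y)
          + γ * ((+ 1 + J) * D₁ - + 2 * (+ 1 + + 2 * J) * D₀))
      ≡⟨ cong (_+_ ΔG) (lincomb-vanishes α β γ rel₁ rel₂ rel₃) ⟩
    ΔG + 0ℤ
      ≡⟨ +-identityʳ ΔG ⟩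
    ΔG ∎
    where
    ΔG = certificate N (+ 1 + J) X₁ D₁ - certificate N J Y D₀
    α β γ : ℤ
    α = + 9 * D₁ * ((N + + 1) * X₀ + (N - J) * X₁)
    β = - (((N + + 2 - + 3 * (J + + 1)) * Y + (+ 2 * (N + + 2) + + 3 * (J + + 1)) * X₁) * D₁)
    γ = (+ 4 * N + + 5 - + 3 * J) * (Y * Y)
    expand : ∀ N J X₀ X₁ Y D₀ D₁ →
      + 9 * ((N + + 1) * (N + + 1)) * (X₀ * (X₀ * D₁)) - (+ 10 * N * N + + 30 * N + + 23) * (X₁ * (X₁ * D₁))
        + (N + + 2) * (N + + 2) * ((Y + X₁) * ((Y + X₁) * D₁))
      ≡ (- (+ 2 * (+ 1 + + 2 * (+ 1 + J)) * (+ 4 * N + + 5 - + 3 * (+ 1 + J))) * (X₁ * X₁) * D₁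
         - - (+ 2 * (+ 1 + + 2 * J) * (+ 4 * N + + 5 - + 3 * J)) * (Y * Y) * D₀)
        + (+ 9 * D₁ * ((N + + 1) * X₀ + (N - J) * X₁)
             * ((+ 1 + N) * X₀ + (+ 1 + J) * X₁ - (+ 1 + N) * X₁)
          + - (((N + + 2 - + 3 * (J + + 1)) * Y + (+ 2 * (N + + 2) + + 3 * (J + + 1)) * X₁) * D₁)
             * ((+ 1 + J) * X₁ + J * Y - (+ 1 + N) * Y)
          + (+ 4 * N + + 5 - + 3 * J) * (Y * Y) * ((+ 1 + J) * D₁ - + 2 * (+ 1 + + 2 * J) * D₀))
    expand = solve-∀

  pos-F : ∀ n k → + F n k ≡ + (n C k) * (+ (n C k) * + centralBinomial k)
  pos-F n k = trans (pos-* (n C k) _) (cong (+ (n C k) *_) (pos-* (n C k) (centralBinomial k)))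

  pos-+* : ∀ p x q y r z → p ℕ.* x ℕ.+ q ℕ.* y ≡ r ℕ.* z → + p * + x + + q * + y ≡ + r * + z
  pos-+* p x q y r z eq =
    trans (sym (trans (pos-+ (p ℕ.* x) _) (cong₂ _+_ (pos-* p x) (pos-* q y))))
          (trans (cong +_ eq) (pos-* r z))

  centralBinomial-sucℤ : ∀ m →
    (+ 1 + + m) * + centralBinomial (suc m) ≡ + 2 * (+ 1 + + 2 * + m) * + centralBinomial m
  centralBinomial-sucℤ m = begin
    + suc m * + c (suc m)            ≡⟨ pos-* (suc m) (c (suc m)) ⟨
    + (suc m ℕ.* c (suc m))          ≡⟨ cong +_ (centralBinomial-suc m) ⟩
    + (2 ℕ.* suc (2 ℕ.* m) ℕ.* c m)  ≡⟨ pos-* (2 ℕ.* suc (2 ℕ.* m)) (c m) ⟩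
    + (2 ℕ.* suc (2 ℕ.* m)) * + c m  ≡⟨ cong (_* + c m) (pos-* 2 (suc (2 ℕ.* m))) ⟩
    + 2 * (+ 1 + + (2 ℕ.* m)) * + c m ≡⟨ cong (λ x → + 2 * (+ 1 + x) * + c m) (pos-* 2 m) ⟩
    + 2 * (+ 1 + + 2 * + m) * + c m  ∎
    where
    c = centralBinomial

  recurrence-F≡ΔG : ∀ n k →
    recurrence (+ n) (+ F n k) (+ F (suc n) k) (+ F (suc (suc n)) k) ≡ G n (suc k) - G n k
  recurrence-F≡ΔG n zero = at-zero (+ n)
    where
    at-zero : ∀ N →
      + 9 * ((N + + 1) * (N + + 1)) * + 1 - (+ 10 * N * N + + 30 * N + + 23) * + 1
        + (N + + 2) * (N + + 2) * + 1
        ≡ - (+ 2 * (+ 1 + + 2 * + 0) * (+ 4 * N + + 5 - + 3 * + 0)) * (+ 1 * + 1) * + 1 - + 0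
    at-zero = solve-∀
  recurrence-F≡ΔG n (suc j) =
    trans (recurrence-cong (+ n) (pos-F n (suc j)) (pos-F (suc n) (suc j))
                                 (trans (pos-F (suc (suc n)) (suc j)) (cong (λ x → x * (x * D₁)) pascal)))
          (wz-identity (+ n) (+ j) X₀ X₁ Y (+ centralBinomial j) D₁
                       (pos-+* (suc n) (n C suc j) (suc j) (suc n C suc j) (suc n) (suc n C suc j)
                               row-absorption)
                       (pos-+* (suc j) (suc n C suc j) j (suc n C j) (suc n) (suc n C j)
                               ([k+1]*nC[k+1]+k*nCk≡n*nCk (suc n) j))
                       (centralBinomial-sucℤ j))
    where
    X₀ = + (n C suc j)
    X₁ = + (suc n C suc j)
    Y  = + (suc n C j)
    D₁ = + centralBinomial (suc j)
    pascal : + (suc (suc n) C suc j) ≡ Y + X₁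
    pascal = trans (cong +_ (sym (nCk+nC[k+1]≡[n+1]C[k+1] (suc n) j))) (pos-+ (suc n C j) _)
    row-absorption : suc n ℕ.* (n C suc j) ℕ.+ suc j ℕ.* (suc n C suc j) ≡ suc n ℕ.* (suc n C suc j)
    row-absorption = trans (cong (ℕ._+ suc j ℕ.* (suc n C suc j)) (sym ([k+1]*[n+1]C[k+1]≡[n+1]*nCk n (suc j))))
                           ([k+1]*nC[k+1]+k*nCk≡n*nCk (suc n) (suc j))

  recurrence-partialSum : ∀ n M →
    recurrence (+ n) (+ sumBelow M (F n)) (+ sumBelow M (F (suc n))) (+ sumBelow M (F (suc (suc n)))) ≡ G n M
  recurrence-partialSum n zero = vanish (+ n)
    where
    vanish : ∀ N → + 9 * ((N + + 1) * (N + + 1)) * + 0 - (+ 10 * N * N + + 30 * N + + 23) * + 0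
                     + (N + + 2) * (N + + 2) * + 0 ≡ 0ℤ
    vanish = solve-∀
  recurrence-partialSum n (suc M) = begin
    recurrence (+ n) (+ sumBelow (suc M) (F n)) (+ sumBelow (suc M) (F (suc n)))
                     (+ sumBelow (suc M) (F (suc (suc n))))
      ≡⟨ recurrence-cong (+ n) (snoc n) (snoc (suc n)) (snoc (suc (suc n))) ⟩
    recurrence (+ n) (+ sumBelow M (F n) + + F n M) (+ sumBelow M (F (suc n)) + + F (suc n) M)
                     (+ sumBelow M (F (suc (suc n))) + + F (suc (suc n)) M)
      ≡⟨ recurrence-+ (+ n) _ _ _ _ _ _ ⟩
    recurrence (+ n) (+ sumBelow M (F n)) (+ sumBelow M (F (suc n))) (+ sumBelow M (F (suc (suc n))))
      + recurrence (+ n) (+ F n M) (+ F (suc n) M) (+ F (suc (suc n)) M)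
      ≡⟨ cong₂ _+_ (recurrence-partialSum n M) (recurrence-F≡ΔG n M) ⟩
    G n M + (G n (suc M) - G n M)
      ≡⟨ telescope (G n M) (G n (suc M)) ⟩
    G n (suc M) ∎
    where
    snoc : ∀ m → + sumBelow (suc M) (F m) ≡ + sumBelow M (F m) + + F m M
    snoc m = trans (cong +_ (∑<-snoc M (F m))) (pos-+ (sumBelow M (F m)) (F m M))
    telescope : ∀ x y → x + (y - x) ≡ y
    telescope = solve-∀

  recurrence-b : ∀ n → recurrence (+ n) (+ b n) (+ b (suc n)) (+ b (suc (suc n))) ≡ 0ℤ
  recurrence-b n = begin
    recurrence (+ n) (+ b n) (+ b (suc n)) (+ b (suc (suc n)))
      ≡⟨ recurrence-cong (+ n) (as-sum n (≤′-step (≤′-step ≤′-refl))) (as-sum (suc n) (≤′-step ≤′-refl))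
                               (as-sum (suc (suc n)) ≤′-refl) ⟩
    recurrence (+ n) (+ sumBelow M (F n)) (+ sumBelow M (F (suc n))) (+ sumBelow M (F (suc (suc n))))
      ≡⟨ recurrence-partialSum n M ⟩
    certificate (+ n) (+ suc (suc n)) (+ (suc n C suc (suc n))) (+ centralBinomial (suc (suc n)))
      ≡⟨ cong (λ x → certificate (+ n) (+ suc (suc n)) (+ x) (+ centralBinomial (suc (suc n))))
              (k>n⇒nCk≡0 (n<1+n (suc n))) ⟩
    certificate (+ n) (+ suc (suc n)) (+ 0) (+ centralBinomial (suc (suc n)))
      ≡⟨ certificate-zero (+ n) (+ suc (suc n)) (+ centralBinomial (suc (suc n))) ⟩
    0ℤ ∎
    where
    M = suc (suc (suc n))
    as-sum : ∀ m → suc m ℕ.≤′ M → + b m ≡ + sumBelow M (F m)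
    as-sum m m<M = cong +_ (trans (binomialSum-unfold m _)
      (sym (∑<-extend (F m) m<M (λ k m<k → cong (λ c → c ℕ.* (c ℕ.* centralBinomial k)) (k>n⇒nCk≡0 m<k)))))
    certificate-zero : ∀ N J D → - (+ 2 * (+ 1 + + 2 * J) * (+ 4 * N + + 5 - + 3 * J)) * (+ 0 * + 0) * D ≡ 0ℤ
    certificate-zero = solve-∀

  recurrence-transfer : ∀ n (A D B : ℕ → ℤ) → (∀ m → A m ≡ D m * B m) →
    (∀ m → (+ 1 + + m) * D (suc m) ≡ + 2 * (+ 1 + + 2 * + m) * D m) →
    recurrence (+ n) (B n) (B (suc n)) (B (suc (suc n))) ≡ 0ℤ →
    + 36 * (+ 2 * + n + + 3) * (+ 2 * + n + + 1) * (+ n + + 1) * A n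
      - + 2 * (+ 2 * + n + + 3) * (+ 10 * + n * + n + + 30 * + n + + 23) * A (suc n)
      + (+ n + + 2) * (+ n + + 2) * (+ n + + 2) * A (suc (suc n))
      ≡ 0ℤ
  recurrence-transfer n A D B A≡DB D-rec B-rec rewrite A≡DB n | A≡DB (suc n) | A≡DB (suc (suc n)) =
    trans (expand (+ n) (D n) (D (suc n)) (D (suc (suc n))) (B n) (B (suc n)) (B (suc (suc n))))
          (lincomb-vanishes (+ 2 * (+ 2 * + n + + 3) * D (suc n))
                            (- (+ 18 * (+ 2 * + n + + 3) * (+ n + + 1) * B n))
                            ((+ n + + 2) * (+ n + + 2) * B (suc (suc n)))
                            B-rec (D-rec n) (D-rec (suc n)))
    where
    expand : ∀ N d₀ d₁ d₂ b₀ b₁ b₂ →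
      + 36 * (+ 2 * N + + 3) * (+ 2 * N + + 1) * (N + + 1) * (d₀ * b₀)
        - + 2 * (+ 2 * N + + 3) * (+ 10 * N * N + + 30 * N + + 23) * (d₁ * b₁)
        + (N + + 2) * (N + + 2) * (N + + 2) * (d₂ * b₂)
      ≡ + 2 * (+ 2 * N + + 3) * d₁
          * (+ 9 * ((N + + 1) * (N + + 1)) * b₀ - (+ 10 * N * N + + 30 * N + + 23) * b₁
             + (N + + 2) * (N + + 2) * b₂ - 0ℤ)
        + - (+ 18 * (+ 2 * N + + 3) * (N + + 1) * b₀) * ((+ 1 + N) * d₁ - + 2 * (+ 1 + + 2 * N) * d₀)
        + (N + + 2) * (N + + 2) * b₂ * ((+ 1 + (+ 1 + N)) * d₂ - + 2 * (+ 1 + + 2 * (+ 1 + N)) * d₁)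
    expand = solve-∀

open import Data.Nat using (ℕ; NonZero)
open import Data.Integer using (+_; _+_; _-_; _*_)
open import Data.Integer.Properties using (pos-*)
open import Relation.Binary.PropositionalEquality using (_≡_; cong; trans)
open Binomials using (centralBinomial)
open Enumeration using (a≡centralBinomial*b; b)
open Recurrence using (recurrence-transfer; centralBinomial-sucℤ; recurrence-b)

-- The identity holds for n = 0 as well.
theorem4 : (n : ℕ) → .{{_ : NonZero n}} →
    (+ 36) * (+ 2 * + n + + 3) * (+ 2 * + n + + 1) * (+ n + + 1) * + a n
    - (+ 2) * (+ 2 * + n + + 3) * (+ 10 * + n * + n + + 30 * + n + + 23) * + a (Data.Nat.suc n)
    + (+ n + + 2) * (+ n + + 2) * (+ n + + 2) * + a (Data.Nat.suc (Data.Nat.suc n))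
    ≡ + 0
theorem4 n = recurrence-transfer n (λ m → + a m) (λ m → + centralBinomial m) (λ m → + b m)
  (λ m → trans (cong +_ (a≡centralBinomial*b m)) (pos-* (centralBinomial m) (b m)))
  centralBinomial-sucℤ
  (recurrence-b n)
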